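{- Let $1\le k_1<k_2<\cdots<k_s$ be fixed integers with $k_s=2^{r-1}$ a power of two, so that $r=\lfloor\log_2(k_s)\rfloor+1$. For $0\le j\le 2^r-1$ let $\zeta_j=\exp\left(\frac{\pi\sqrt{ -1}\,j}{2^{r-1}}\right)$ and $$c_j(k_1,\dots,k_s)=\frac{1}{2^r}\sum_{i=0}^{2^r-1}(-1)^{\binom{i}{k_1}+\cdots+\binom{i}{k_s}}\zeta_j^{ -i}.$$ Then for $0\le j\le 2^r-1$, $c_j(k_1,\dots,k_s)\neq0$ if and only if $j$ is odd. In particular $c_0(k_1,\dots,k_s)=0$.
   Context: These $c_j$ are the coefficients in the closed form $\sum_{i=0}^n(-1)^{\binom{i}{k_1}+\cdots+\binom{i}{k_s}}\binom{n}{i}=c_0 2^n+\sum_{j=1}^{2^r-1}c_j(1+\zeta_j)^n$ of the exponential sum of the symmetric Boolean function $\sigma_{n,k_1}+\cdots+\sigma_{n,k_s}$. -}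

module Defs where

open import Data.Nat as ℕ using (ℕ; zero; suc; _+_; _*_; _∸_; _^_; _%_)
open import Data.Nat.Combinatorics using (_C_)
open import Data.Fin using (Fin; zero; suc; fromℕ; inject₁)
open import Data.List using (List; []; _∷_; foldr; upTo; map)
open import Data.Rational as ℚ using (ℚ; 0ℚ; 1ℚ; ½)
open import Data.Bool using (if_then_else_)
open import Relation.Nullary.Decidable using (does)
open import Relation.Binary.PropositionalEquality using (_≡_)
open import Relation.Nullary using (¬_)

-- Elements of the cyclotomic field ℚ(ω), ω = exp(π i / N), realised as
-- ℚ[x]/(x^N + 1) (x^N + 1 is the 2N-th cyclotomic polynomial when N is a
-- power of two, hence irreducible): an element is its coefficient vector
-- on the basis 1, x, …, x^(N-1); x plays the role of ω.
Cyc : ℕ → Set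
Cyc N = Fin N → ℚ

zeroC : ∀ {N} → Cyc N
zeroC _ = 0ℚ

oneC : ∀ {N} → Cyc N
oneC {zero}  ()
oneC {suc N} zero    = 1ℚ
oneC {suc N} (suc _) = 0ℚ

_+C_ : ∀ {N} → Cyc N → Cyc N → Cyc N
(p +C q) t = p t ℚ.+ q t

_·C_ : ∀ {N} → ℚ → Cyc N → Cyc N
(a ·C p) t = a ℚ.* p t

mulX : ∀ {N} → Cyc N → Cyc N
mulX {zero}  p ()
mulX {suc N} p zero    = ℚ.- p (fromℕ N)
mulX {suc N} p (suc t) = p (inject₁ t)

ωpow : ∀ {N} → ℕ → Cyc N
ωpow zero    = oneC
ωpow (suc e) = mulX (ωpow e)

-- ω^(-e) = ω^(e (2N - 1)), since ω^(2N) = 1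
ωpowInv : (N : ℕ) → ℕ → Cyc N
ωpowInv N e = ωpow (e * (2 * N ∸ 1))

ΣC : ∀ {N} → ℕ → (ℕ → Cyc N) → Cyc N
ΣC n f = foldr (λ i acc → f i +C acc) zeroC (upTo n)

inv2^ : ℕ → ℚ
inv2^ zero    = 1ℚ
inv2^ (suc r) = ½ ℚ.* inv2^ r

binomSum : List ℕ → ℕ → ℕ
binomSum ks i = foldr (λ k acc → (i C k) + acc) 0 ks

sgn : ℕ → ℚ
sgn n = if does (n % 2 ℕ.≟ 0) then 1ℚ else ℚ.- 1ℚ

-- With k_s = 2^m, r = m + 1, N = 2^(r-1) = 2^m, ζ_j = ω^j:
-- c_j(k_1,…,k_s) = 2^(-r) Σ_{i=0}^{2^r - 1} (-1)^(Σ_l binom(i,k_l)) ζ_j^(-i)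
coeff : (m : ℕ) → List ℕ → ℕ → Cyc (2 ^ m)
coeff m ks j =
  inv2^ (suc m) ·C ΣC (2 ^ suc m) (λ i → sgn (binomSum ks i) ·C ωpowInv (2 ^ m) (i * j))

IsZeroC : ∀ {N} → Cyc N → Set
IsZeroC p = ∀ t → p t ≡ 0ℚ

-- Lucas' theorem mod 2 in the form (1 + x)^(i + 2^m) ≡ (1 + x)^i (1 + x^(2^m)) shows that
-- binom(i, k) mod 2 is 2^m-periodic in i for k < 2^m, while binom(i, 2^m) changes parity
-- under i ↦ i + 2^m.  Since k_s = 2^m, the sign s(i) = (-1)^(Σ binom(i, k_l)) is therefore
-- antiperiodic with antiperiod N = 2^m, and as ζ_j^(-N) = (-1)^j the defining sum of c_j
-- collapses to (1 - (-1)^j) 2^(-r) Σ_{i<N} s(i) ζ_j^(-i).  This vanishes for even j.  For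
-- odd j, write the half sum in the basis 1, ω, …, ω^(N-1): ω^(-ij) contributes to the
-- coordinate of 1 only if N ∣ ij, i.e. only for i = 0, so that coordinate is ±2^(1-r) ≠ 0.
module Submission where

open import Defs
open import Data.Bool using (true; false; if_then_else_)
open import Data.Fin using (Fin; toℕ; fromℕ; inject₁) renaming (zero to fzero; suc to fsuc)
open import Data.Fin.Properties using (toℕ-fromℕ; toℕ-inject₁; toℕ<n)
open import Data.List using (List; []; _∷_; last; foldr; applyUpTo)
open import Data.List.Relation.Unary.All using (All)
open import Data.List.Relation.Unary.Linked using (Linked; _∷_)
open import Data.Maybe using (just)
open import Data.Maybe.Properties using (just-injective)
open import Data.Nat using (ℕ; zero; suc; _+_; _*_; _∸_; _^_; _%_; _/_; _<_; _≤_; s≤s; z≤n; NonZero)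
open import Data.Nat.Combinatorics using (_C_; nCk+nC[k+1]≡[n+1]C[k+1])
open import Data.Nat.Divisibility
  using (_∣_; divides; divides-refl; ∣-trans; *-cancelˡ-∣; *-monoʳ-∣; ∣⇒≤; n∣m⇒m%n≡0; m%n≡0⇒n∣m; 1∣_)
open import Data.Nat.DivMod
  using ( %-distribˡ-+; m*n%n≡0; [m+kn]%n≡m%n; m<n⇒m%n≡m; m<n⇒m/n≡0; m*n/n≡m
        ; +-distrib-/-∣ʳ; m≡m%n+[m/n]*n; m%n<n)
open import Data.Nat.Primality using (euclidsLemma; prime?)
open import Data.Nat.Properties as ℕ using (+-assoc; +-comm; +-identityʳ)
import Data.Nat.Tactic.RingSolver as ℕ-Solver
open import Data.Product using (_×_; _,_; proj₁; proj₂)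
open import Data.Rational as ℚ using (ℚ; 0ℚ; 1ℚ; ½)
import Data.Rational.Properties as ℚ
open import Data.Sum using (_⊎_; inj₁; inj₂; [_,_]′)
open import Function using (_∘_; id)
open import Function.Bundles using (_⇔_; mk⇔)
open import Level using (0ℓ)
open import Relation.Binary.Bundles using (Setoid)
open import Relation.Binary.PropositionalEquality
open import Relation.Binary.Structures using (IsEquivalence)
open import Relation.Nullary using (¬_; contradiction)
open import Relation.Nullary.Decidable using (does; yes; no; dec-true; dec-false; from-yes; dec⇒maybe)
open import Tactic.RingSolver using (solve-∀)
open import Tactic.RingSolver.Core.AlmostCommutativeRing using (AlmostCommutativeRing; fromCommutativeRing)

infix 4 _≡₂_
record _≡₂_ (a b : ℕ) : Set where
  constructor mod2
  field mod2-≡ : a % 2 ≡ b % 2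
open _≡₂_

≡₂-isEquivalence : IsEquivalence _≡₂_
≡₂-isEquivalence = record
  { refl  = mod2 refl
  ; sym   = λ (mod2 p) → mod2 (sym p)
  ; trans = λ (mod2 p) (mod2 q) → mod2 (trans p q)
  }

≡₂-setoid : Setoid 0ℓ 0ℓ
≡₂-setoid = record { isEquivalence = ≡₂-isEquivalence }

≡⇒≡₂ : ∀ {a b} → a ≡ b → a ≡₂ b
≡⇒≡₂ refl = mod2 refl

+-cong-≡₂ : ∀ {a a′ b b′} → a ≡₂ a′ → b ≡₂ b′ → a + b ≡₂ a′ + b′
+-cong-≡₂ {a} {a′} {b} {b′} (mod2 p) (mod2 q) = mod2 (begin
  (a + b) % 2             ≡⟨ %-distribˡ-+ a b 2 ⟩
  (a % 2 + b % 2) % 2     ≡⟨ cong₂ (λ x y → (x + y) % 2) p q ⟩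
  (a′ % 2 + b′ % 2) % 2   ≡⟨ %-distribˡ-+ a′ b′ 2 ⟨
  (a′ + b′) % 2           ∎)
  where open ≡-Reasoning

+-congˡ-≡₂ : ∀ a {b b′} → b ≡₂ b′ → a + b ≡₂ a + b′
+-congˡ-≡₂ a = +-cong-≡₂ {a} (mod2 refl)

n+n≡₂0 : ∀ n → n + n ≡₂ 0
n+n≡₂0 n = mod2 (begin
  (n + n) % 2   ≡⟨ cong (λ x → (n + x) % 2) (+-identityʳ n) ⟨
  (2 * n) % 2   ≡⟨ cong (_% 2) (ℕ.*-comm 2 n) ⟩
  (n * 2) % 2   ≡⟨ m*n%n≡0 n 2 ⟩
  0             ∎)
  where open ≡-Reasoning

x+y+y≡₂x : ∀ x y → x + y + y ≡₂ x
x+y+y≡₂x x y = begin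
  x + y + y     ≡⟨ +-assoc x y y ⟩
  x + (y + y)   ≈⟨ +-congˡ-≡₂ x (n+n≡₂0 y) ⟩
  x + 0         ≡⟨ +-identityʳ x ⟩
  x             ∎
  where open import Relation.Binary.Reasoning.Setoid ≡₂-setoid

x+y+[y+z]≡₂x+z : ∀ x y z → (x + y) + (y + z) ≡₂ x + z
x+y+[y+z]≡₂x+z x y z = begin
  (x + y) + (y + z)   ≡⟨ +-assoc x y (y + z) ⟩
  x + (y + (y + z))   ≡⟨ cong (x +_) (+-assoc y y z) ⟨
  x + ((y + y) + z)   ≈⟨ +-congˡ-≡₂ x (+-cong-≡₂ (n+n≡₂0 y) (mod2 refl)) ⟩
  x + z               ∎
  where open import Relation.Binary.Reasoning.Setoid ≡₂-setoid

%2≡0⊎%2≡1 : ∀ j → j % 2 ≡ 0 ⊎ j % 2 ≡ 1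
%2≡0⊎%2≡1 0             = inj₁ refl
%2≡0⊎%2≡1 1             = inj₂ refl
%2≡0⊎%2≡1 (suc (suc j)) = %2≡0⊎%2≡1 j

sgn-cong : ∀ {a b} → a ≡₂ b → sgn a ≡ sgn b
sgn-cong (mod2 p) = cong (λ x → if does (x ℕ.≟ 0) then 1ℚ else ℚ.- 1ℚ) p

sgn-suc : ∀ n → sgn (suc n) ≡ ℚ.- sgn n
sgn-suc 0             = refl
sgn-suc 1             = refl
sgn-suc (suc (suc n)) = sgn-suc n   -- (2 + n) % 2 reduces to n % 2

sgn-+ : ∀ a b → sgn (a + b) ≡ sgn a ℚ.* sgn b
sgn-+ zero    b = sym (ℚ.*-identityˡ (sgn b))
sgn-+ (suc a) b = begin
  sgn (suc (a + b))       ≡⟨ sgn-suc (a + b) ⟩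
  ℚ.- sgn (a + b)         ≡⟨ cong ℚ.-_ (sgn-+ a b) ⟩
  ℚ.- (sgn a ℚ.* sgn b)   ≡⟨ ℚ.neg-distribˡ-* (sgn a) (sgn b) ⟩
  ℚ.- sgn a ℚ.* sgn b     ≡⟨ cong (ℚ._* sgn b) (sgn-suc a) ⟨
  sgn (suc a) ℚ.* sgn b   ∎
  where open ≡-Reasoning

sgn+sgn≢0 : ∀ k → ¬ sgn k ℚ.+ 1ℚ ℚ.* sgn k ≡ 0ℚ
sgn+sgn≢0 k with does (k % 2 ℕ.≟ 0)
... | true  = λ ()
... | false = λ ()

-- Binomial coefficients modulo 2

-- The coefficientwise reading of (1 + x)^(i + P) ≡ (1 + x)^i (1 + x^P) (mod 2).
record ShiftsBinomials (P : ℕ) : Set where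
  field
    low  : ∀ i {k} → k < P → (i + P) C k ≡₂ i C k
    high : ∀ i d → (i + P) C (P + d) ≡₂ i C (P + d) + i C d

shiftsBinomials-1 : ShiftsBinomials 1
shiftsBinomials-1 = record { low = low ; high = high }
  where
  low : ∀ i {k} → k < 1 → (i + 1) C k ≡₂ i C k
  low i (s≤s z≤n) = ≡⇒≡₂ (cong (_C 0) (+-comm i 1))
  high : ∀ i d → (i + 1) C (1 + d) ≡₂ i C (1 + d) + i C d
  high i d = ≡⇒≡₂ (begin
    (i + 1) C suc d     ≡⟨ cong (_C suc d) (+-comm i 1) ⟩
    suc i C suc d       ≡⟨ nCk+nC[k+1]≡[n+1]C[k+1] i d ⟨
    i C d + i C suc d   ≡⟨ +-comm (i C d) (i C suc d) ⟩
    i C suc d + i C d   ∎)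
    where open ≡-Reasoning

shiftsBinomials-double : ∀ {P} → ShiftsBinomials P → ShiftsBinomials (P + P)
shiftsBinomials-double {P} S = record { low = low ; high = high }
  where
  open ShiftsBinomials S renaming (low to lowP; high to highP)
  open import Relation.Binary.Reasoning.Setoid ≡₂-setoid

  low-above : ∀ i {d} → d < P → (i + (P + P)) C (P + d) ≡₂ i C (P + d)
  low-above i {d} d<P = begin
    (i + (P + P)) C (P + d)           ≡⟨ cong (_C (P + d)) (+-assoc i P P) ⟨
    (i + P + P) C (P + d)             ≈⟨ highP (i + P) d ⟩
    (i + P) C (P + d) + (i + P) C d   ≈⟨ +-cong-≡₂ (highP i d) (lowP i d<P) ⟩
    i C (P + d) + i C d + i C d       ≈⟨ x+y+y≡₂x (i C (P + d)) (i C d) ⟩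
    i C (P + d)                       ∎

  low : ∀ i {k} → k < P + P → (i + (P + P)) C k ≡₂ i C k
  low i {k} k<2P with k ℕ.<? P
  ... | yes k<P = begin
    (i + (P + P)) C k   ≡⟨ cong (_C k) (+-assoc i P P) ⟨
    (i + P + P) C k     ≈⟨ lowP (i + P) k<P ⟩
    (i + P) C k         ≈⟨ lowP i k<P ⟩
    i C k               ∎
  ... | no k≮P = subst (λ k → (i + (P + P)) C k ≡₂ i C k) P+d≡k
          (low-above i (ℕ.+-cancelˡ-< P _ P (subst (_< P + P) (sym P+d≡k) k<2P)))
    where
    P+d≡k : P + (k ∸ P) ≡ k
    P+d≡k = ℕ.m+[n∸m]≡n (ℕ.≮⇒≥ k≮P)

  high : ∀ i d → (i + (P + P)) C ((P + P) + d) ≡₂ i C ((P + P) + d) + i C d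
  high i d = begin
    (i + (P + P)) C ((P + P) + d)                         ≡⟨ cong₂ _C_ (sym (+-assoc i P P)) (+-assoc P P d) ⟩
    (i + P + P) C (P + (P + d))                           ≈⟨ highP (i + P) (P + d) ⟩
    (i + P) C (P + (P + d)) + (i + P) C (P + d)           ≈⟨ +-cong-≡₂ (highP i (P + d)) (highP i d) ⟩
    (i C (P + (P + d)) + i C (P + d)) + (i C (P + d) + i C d)
                                                          ≈⟨ x+y+[y+z]≡₂x+z _ (i C (P + d)) (i C d) ⟩
    i C (P + (P + d)) + i C d                             ≡⟨ cong (λ k → i C k + i C d) (+-assoc P P d) ⟨
    i C ((P + P) + d) + i C d                             ∎

shiftsBinomials-2^ : ∀ m → ShiftsBinomials (2 ^ m)
shiftsBinomials-2^ zero    = shiftsBinomials-1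
shiftsBinomials-2^ (suc m) = subst ShiftsBinomials (cong (2 ^ m +_) (sym (+-identityʳ (2 ^ m))))
  (shiftsBinomials-double (shiftsBinomials-2^ m))

head≤last : ∀ {P} k ks → Linked _<_ (k ∷ ks) → last (k ∷ ks) ≡ just P → k ≤ P
head≤last k []        _          k≡P = ℕ.≤-reflexive (just-injective k≡P)
head≤last k (k′ ∷ ks) (k<k′ ∷ l) eq  = ℕ.<⇒≤ (ℕ.<-≤-trans k<k′ (head≤last k′ ks l eq))

binomSum-shift : ∀ {P} → ShiftsBinomials P → ∀ {ks} → Linked _<_ ks → last ks ≡ just P →
                 ∀ i → binomSum ks (i + P) ≡₂ suc (binomSum ks i)
binomSum-shift {P} S {k ∷ []} _ k≡P i rewrite just-injective k≡P = +-cong-≡₂ C-at-P (mod2 refl)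
  where
  open import Relation.Binary.Reasoning.Setoid ≡₂-setoid
  C-at-P : (i + P) C P ≡₂ suc (i C P)
  C-at-P = begin
    (i + P) C P         ≡⟨ cong ((i + P) C_) (+-identityʳ P) ⟨
    (i + P) C (P + 0)   ≈⟨ ShiftsBinomials.high S i 0 ⟩
    i C (P + 0) + 1     ≡⟨ cong (λ k → i C k + 1) (+-identityʳ P) ⟩
    i C P + 1           ≡⟨ +-comm (i C P) 1 ⟩
    suc (i C P)         ∎
binomSum-shift {P} S {k ∷ k′ ∷ ks} (k<k′ ∷ l) eq i = begin
  (i + P) C k + binomSum (k′ ∷ ks) (i + P)   ≈⟨ +-cong-≡₂ (ShiftsBinomials.low S i k<P) (binomSum-shift S l eq i) ⟩
  i C k + suc (binomSum (k′ ∷ ks) i)         ≡⟨ ℕ.+-suc (i C k) _ ⟩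
  suc (i C k + binomSum (k′ ∷ ks) i)         ∎
  where
  open import Relation.Binary.Reasoning.Setoid ≡₂-setoid
  k<P : k < P
  k<P = ℕ.<-≤-trans k<k′ (head≤last k′ ks l eq)

2^m∣i*odd⇒2^m∣i : ∀ m {i o} → o % 2 ≡ 1 → 2 ^ m ∣ i * o → 2 ^ m ∣ i
2^m∣i*odd⇒2^m∣i zero    {i}     _     _ = 1∣ i
2^m∣i*odd⇒2^m∣i (suc m) {i} {o} o-odd 2^[1+m]∣io
  with euclidsLemma i o (from-yes (prime? 2)) (∣-trans (divides (2 ^ m) (ℕ.*-comm 2 (2 ^ m))) 2^[1+m]∣io)
... | inj₂ 2∣o = contradiction (trans (sym o-odd) (n∣m⇒m%n≡0 o 2 2∣o)) λ ()
... | inj₁ (divides k refl) = subst (2 ^ suc m ∣_) (ℕ.*-comm 2 k) (*-monoʳ-∣ 2 2^m∣k)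
  where
  2^m∣k : 2 ^ m ∣ k
  2^m∣k = 2^m∣i*odd⇒2^m∣i m o-odd (*-cancelˡ-∣ 2
    (subst (2 * 2 ^ m ∣_) (trans (cong (_* o) (ℕ.*-comm k 2)) (ℕ.*-assoc 2 k o)) 2^[1+m]∣io))

2^m∤i*odd : ∀ m {i o} → 0 < i → i < 2 ^ m → o % 2 ≡ 1 → ¬ 2 ^ m ∣ i * o
2^m∤i*odd m {suc i} _ i<2^m o-odd 2^m∣io = ℕ.<⇒≱ i<2^m (∣⇒≤ (2^m∣i*odd⇒2^m∣i m o-odd 2^m∣io))

-- Powers of ω in coordinates

%-/-unique : ∀ {N e r q} .{{_ : NonZero N}} → r < N → e ≡ r + q * N → e % N ≡ r × e / N ≡ q
%-/-unique {N} {r = r} {q} r<N refl =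
  trans ([m+kn]%n≡m%n r q N) (m<n⇒m%n≡m r<N) ,
  trans (+-distrib-/-∣ʳ r (divides-refl q)) (cong₂ _+_ (m<n⇒m/n≡0 r<N) (m*n/n≡m q N))

module _ {n : ℕ} where
  private
    N : ℕ
    N = suc n

  -- ω^e = (-1)^⌊e/N⌋ ω^(e mod N), because ω^N = -1.
  ωpow-explicit : ℕ → Cyc N
  ωpow-explicit e t = if does (e % N ℕ.≟ toℕ t) then sgn (e / N) else 0ℚ

  ωpow-explicit-≡ : ∀ e t → e % N ≡ toℕ t → ωpow-explicit e t ≡ sgn (e / N)
  ωpow-explicit-≡ e t p = cong (if_then sgn (e / N) else 0ℚ) (dec-true (e % N ℕ.≟ toℕ t) p)

  ωpow-explicit-≢ : ∀ e t → ¬ e % N ≡ toℕ t → ωpow-explicit e t ≡ 0ℚ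
  ωpow-explicit-≢ e t p = cong (if_then sgn (e / N) else 0ℚ) (dec-false (e % N ℕ.≟ toℕ t) p)

  mulX-explicit : ∀ e t → mulX (ωpow-explicit e) t ≡ ωpow-explicit (suc e) t
  mulX-explicit e t with ℕ.m≤n⇒m<n∨m≡n (ℕ.≤-pred (m%n<n e N))
  ... | inj₂ r≡n = wraps t
    where
    open ≡-Reasoning
    divMod : suc e % N ≡ 0 × suc e / N ≡ suc (e / N)
    divMod = %-/-unique (s≤s z≤n) (cong suc (trans (m≡m%n+[m/n]*n e N) (cong (_+ e / N * N) r≡n)))
    wraps : ∀ t → mulX (ωpow-explicit e) t ≡ ωpow-explicit (suc e) t
    wraps fzero = begin
      ℚ.- ωpow-explicit e (fromℕ n)   ≡⟨ cong ℚ.-_ (ωpow-explicit-≡ e (fromℕ n) (trans r≡n (sym (toℕ-fromℕ n)))) ⟩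
      ℚ.- sgn (e / N)                 ≡⟨ sgn-suc (e / N) ⟨
      sgn (suc (e / N))               ≡⟨ cong sgn (proj₂ divMod) ⟨
      sgn (suc e / N)                 ≡⟨ ωpow-explicit-≡ (suc e) fzero (proj₁ divMod) ⟨
      ωpow-explicit (suc e) fzero     ∎
    wraps (fsuc t) = begin
      ωpow-explicit e (inject₁ t)     ≡⟨ ωpow-explicit-≢ e (inject₁ t) n≢t ⟩
      0ℚ                              ≡⟨ ωpow-explicit-≢ (suc e) (fsuc t) (ℕ.0≢1+n ∘ trans (sym (proj₁ divMod))) ⟨
      ωpow-explicit (suc e) (fsuc t)  ∎
      where
      n≢t : ¬ e % N ≡ toℕ (inject₁ t)
      n≢t r≡t = ℕ.<-irrefl (trans (sym (toℕ-inject₁ t)) (trans (sym r≡t) r≡n)) (toℕ<n t)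
  ... | inj₁ r<n = stays t
    where
    open ≡-Reasoning
    divMod : suc e % N ≡ suc (e % N) × suc e / N ≡ e / N
    divMod = %-/-unique (s≤s r<n) (cong suc (m≡m%n+[m/n]*n e N))
    stays : ∀ t → mulX (ωpow-explicit e) t ≡ ωpow-explicit (suc e) t
    stays fzero = begin
      ℚ.- ωpow-explicit e (fromℕ n)   ≡⟨ cong ℚ.-_ (ωpow-explicit-≢ e (fromℕ n) (λ r≡n → ℕ.<-irrefl (trans r≡n (toℕ-fromℕ n)) r<n)) ⟩
      ℚ.- 0ℚ                          ≡⟨ ωpow-explicit-≢ (suc e) fzero (λ p → ℕ.0≢1+n (trans (sym p) (proj₁ divMod))) ⟨
      ωpow-explicit (suc e) fzero     ∎
    -- does (suc a ℕ.≟ suc b) reduces to does (a ℕ.≟ b).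
    stays (fsuc t) = begin
      ωpow-explicit e (inject₁ t)     ≡⟨ cong (λ k → if does (e % N ℕ.≟ k) then sgn (e / N) else 0ℚ) (toℕ-inject₁ t) ⟩
      (if does (suc (e % N) ℕ.≟ suc (toℕ t)) then sgn (e / N) else 0ℚ)
                                      ≡⟨ cong₂ (λ r q → if does (r ℕ.≟ suc (toℕ t)) then sgn q else 0ℚ) (proj₁ divMod) (proj₂ divMod) ⟨
      ωpow-explicit (suc e) (fsuc t)  ∎

  ωpow≗explicit : ∀ e t → ωpow e t ≡ ωpow-explicit e t
  ωpow≗explicit zero    fzero    = refl
  ωpow≗explicit zero    (fsuc t) = refl
  ωpow≗explicit (suc e) t        = trans (mulX-cong t) (mulX-explicit e t)
    where
    mulX-cong : ∀ t → mulX (ωpow e) t ≡ mulX (ωpow-explicit e) t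
    mulX-cong fzero    = cong ℚ.-_ (ωpow≗explicit e (fromℕ n))
    mulX-cong (fsuc t) = ωpow≗explicit e (inject₁ t)

  ωpow-+* : ∀ e c t → ωpow (e + c * N) t ≡ sgn c ℚ.* ωpow e t
  ωpow-+* e c t = begin
    ωpow (e + c * N) t                                                     ≡⟨ ωpow≗explicit (e + c * N) t ⟩
    (if does ((e + c * N) % N ℕ.≟ toℕ t) then sgn ((e + c * N) / N) else 0ℚ)
                                                                           ≡⟨ cong₂ (λ r q → if does (r ℕ.≟ toℕ t) then sgn q else 0ℚ) ([m+kn]%n≡m%n e c N) e+cN/N ⟩
    (if does (e % N ℕ.≟ toℕ t) then sgn (e / N + c) else 0ℚ)              ≡⟨ scale (does (e % N ℕ.≟ toℕ t)) ⟩
    sgn c ℚ.* ωpow-explicit e t                                            ≡⟨ cong (sgn c ℚ.*_) (ωpow≗explicit e t) ⟨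
    sgn c ℚ.* ωpow e t                                                     ∎
    where
    open ≡-Reasoning
    e+cN/N : (e + c * N) / N ≡ e / N + c
    e+cN/N = trans (+-distrib-/-∣ʳ e (divides-refl c)) (cong (e / N +_) (m*n/n≡m c N))
    scale : ∀ b → (if b then sgn (e / N + c) else 0ℚ) ≡ sgn c ℚ.* (if b then sgn (e / N) else 0ℚ)
    scale true  = trans (sgn-+ (e / N) c) (ℚ.*-comm (sgn (e / N)) (sgn c))
    scale false = sym (ℚ.*-zeroʳ (sgn c))

  ωpow-constant-coordinate : ∀ e → ¬ N ∣ e → ωpow e fzero ≡ 0ℚ
  ωpow-constant-coordinate e N∤e =
    trans (ωpow≗explicit e fzero) (ωpow-explicit-≢ e fzero (N∤e ∘ m%n≡0⇒n∣m e N))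

sumℚ : ℕ → (ℕ → ℚ) → ℚ
sumℚ zero    f = 0ℚ
sumℚ (suc n) f = f 0 ℚ.+ sumℚ n (f ∘ suc)

ΣC-coordinate : ∀ {N} n (f : ℕ → Cyc N) t → ΣC n f t ≡ sumℚ n (λ i → f i t)
ΣC-coordinate n f t = go id n
  where
  go : ∀ h n → foldr (λ i acc → f i +C acc) zeroC (applyUpTo h n) t ≡ sumℚ n (λ i → f (h i) t)
  go h zero    = refl
  go h (suc n) = cong (f (h 0) t ℚ.+_) (go (h ∘ suc) n)

sumℚ-cong : ∀ n {f g} → (∀ i → f i ≡ g i) → sumℚ n f ≡ sumℚ n g
sumℚ-cong zero    f≗g = refl
sumℚ-cong (suc n) f≗g = cong₂ ℚ._+_ (f≗g 0) (sumℚ-cong n (f≗g ∘ suc))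

sumℚ-+ : ∀ a b f → sumℚ (a + b) f ≡ sumℚ a f ℚ.+ sumℚ b (λ i → f (a + i))
sumℚ-+ zero    b f = sym (ℚ.+-identityˡ _)
sumℚ-+ (suc a) b f = trans (cong (f 0 ℚ.+_) (sumℚ-+ a b (f ∘ suc))) (sym (ℚ.+-assoc (f 0) _ _))

sumℚ-*ˡ : ∀ n c f → sumℚ n (λ i → c ℚ.* f i) ≡ c ℚ.* sumℚ n f
sumℚ-*ˡ zero    c f = sym (ℚ.*-zeroʳ c)
sumℚ-*ˡ (suc n) c f = trans (cong (c ℚ.* f 0 ℚ.+_) (sumℚ-*ˡ n c (f ∘ suc))) (sym (ℚ.*-distribˡ-+ c (f 0) _))

sumℚ-zero : ∀ n f → (∀ i → i < n → f i ≡ 0ℚ) → sumℚ n f ≡ 0ℚ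
sumℚ-zero zero    f f≡0 = refl
sumℚ-zero (suc n) f f≡0 = cong₂ ℚ._+_ (f≡0 0 (s≤s z≤n)) (sumℚ-zero n (f ∘ suc) (λ i i<n → f≡0 (suc i) (s≤s i<n)))

ℚ-ring : AlmostCommutativeRing 0ℓ 0ℓ
ℚ-ring = fromCommutativeRing ℚ.+-*-commutativeRing (λ x → dec⇒maybe (0ℚ ℚ.≟ x))

½*x≡0⇒x≡0 : ∀ {x} → ½ ℚ.* x ≡ 0ℚ → x ≡ 0ℚ
½*x≡0⇒x≡0 {x} ½x≡0 = begin
  x                  ≡⟨ ℚ.*-identityˡ x ⟨
  (2ℚ ℚ.* ½) ℚ.* x   ≡⟨ ℚ.*-assoc 2ℚ ½ x ⟩
  2ℚ ℚ.* (½ ℚ.* x)   ≡⟨ cong (2ℚ ℚ.*_) ½x≡0 ⟩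
  2ℚ ℚ.* 0ℚ          ≡⟨ ℚ.*-zeroʳ 2ℚ ⟩
  0ℚ                 ∎
  where
  open ≡-Reasoning
  2ℚ : ℚ
  2ℚ = 1ℚ ℚ.+ 1ℚ

inv2^*x≡0⇒x≡0 : ∀ r {x} → inv2^ r ℚ.* x ≡ 0ℚ → x ≡ 0ℚ
inv2^*x≡0⇒x≡0 zero    {x} x≡0 = trans (sym (ℚ.*-identityˡ x)) x≡0
inv2^*x≡0⇒x≡0 (suc r) {x} eq  = inv2^*x≡0⇒x≡0 r (½*x≡0⇒x≡0 (trans (sym (ℚ.*-assoc ½ (inv2^ r) x)) eq))

-- c_j for the sign pattern (-1)^(g i); coeff m ks is coeffOf (2 ^ m) (suc m) (binomSum ks) by definition.
coeffOf : (N r : ℕ) → (ℕ → ℕ) → ℕ → Cyc N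
coeffOf N r g j = inv2^ r ·C ΣC (2 * N) (λ i → sgn (g i) ·C ωpowInv N (i * j))

module _ {n : ℕ} (g : ℕ → ℕ) (g-antiperiodic : ∀ i → g (suc n + i) ≡₂ suc (g i)) (j : ℕ) where
  private
    N M : ℕ
    N = suc n
    M = 2 * N ∸ 1

  term : ℕ → Fin N → ℚ
  term i t = sgn (g i) ℚ.* ωpow ((i * j) * M) t

  halfSum : Fin N → ℚ
  halfSum t = sumℚ N (λ i → term i t)

  j*M≡₂j : j * M ≡₂ j
  j*M≡₂j = mod2 (trans (cong (_% 2) (j*M≡j+[j*n]*2 j n)) ([m+kn]%n≡m%n j (j * n) 2))
    where
    j*M≡j+[j*n]*2 : ∀ j n → j * (n + (suc n + 0)) ≡ j + (j * n) * 2
    j*M≡j+[j*n]*2 = ℕ-Solver.solve-∀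

  term-shift : ∀ i t → term (N + i) t ≡ ℚ.- sgn j ℚ.* term i t
  term-shift i t = begin
    sgn (g (N + i)) ℚ.* ωpow (((N + i) * j) * M) t
      ≡⟨ cong₂ ℚ._*_ (trans (sgn-cong (g-antiperiodic i)) (sgn-suc (g i))) (cong (λ e → ωpow e t) (exponent N i j M)) ⟩
    ℚ.- sgn (g i) ℚ.* ωpow ((i * j) * M + (j * M) * N) t
      ≡⟨ cong (ℚ.- sgn (g i) ℚ.*_) (ωpow-+* ((i * j) * M) (j * M) t) ⟩
    ℚ.- sgn (g i) ℚ.* (sgn (j * M) ℚ.* ωpow ((i * j) * M) t)
      ≡⟨ cong (λ s → ℚ.- sgn (g i) ℚ.* (s ℚ.* ωpow ((i * j) * M) t)) (sgn-cong j*M≡₂j) ⟩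
    ℚ.- sgn (g i) ℚ.* (sgn j ℚ.* ωpow ((i * j) * M) t)
      ≡⟨ swap-signs (sgn (g i)) (sgn j) (ωpow ((i * j) * M) t) ⟩
    ℚ.- sgn j ℚ.* term i t
      ∎
    where
    open ≡-Reasoning
    exponent : ∀ N i j M → ((N + i) * j) * M ≡ (i * j) * M + (j * M) * N
    exponent = ℕ-Solver.solve-∀
    swap-signs : ∀ a b w → ℚ.- a ℚ.* (b ℚ.* w) ≡ ℚ.- b ℚ.* (a ℚ.* w)
    swap-signs = solve-∀ ℚ-ring

  coeffOf-coordinate : ∀ r t → coeffOf N r g j t ≡ inv2^ r ℚ.* (halfSum t ℚ.+ ℚ.- sgn j ℚ.* halfSum t)
  coeffOf-coordinate r t = cong (inv2^ r ℚ.*_) (begin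
    ΣC (2 * N) (λ i → sgn (g i) ·C ωpowInv N (i * j)) t
                                                        ≡⟨ ΣC-coordinate (2 * N) (λ i → sgn (g i) ·C ωpowInv N (i * j)) t ⟩
    sumℚ (N + (N + 0)) (λ i → term i t)                 ≡⟨ sumℚ-+ N (N + 0) (λ i → term i t) ⟩
    halfSum t ℚ.+ sumℚ (N + 0) (λ i → term (N + i) t)   ≡⟨ cong (λ k → halfSum t ℚ.+ sumℚ k (λ i → term (N + i) t)) (+-identityʳ N) ⟩
    halfSum t ℚ.+ sumℚ N (λ i → term (N + i) t)         ≡⟨ cong (halfSum t ℚ.+_) (sumℚ-cong N (λ i → term-shift i t)) ⟩
    halfSum t ℚ.+ sumℚ N (λ i → ℚ.- sgn j ℚ.* term i t) ≡⟨ cong (halfSum t ℚ.+_) (sumℚ-*ˡ N (ℚ.- sgn j) (λ i → term i t)) ⟩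
    halfSum t ℚ.+ ℚ.- sgn j ℚ.* halfSum t               ∎)
    where open ≡-Reasoning

  coeffOf-even : ∀ r → j % 2 ≡ 0 → IsZeroC (coeffOf N r g j)
  coeffOf-even r j-even t = begin
    coeffOf N r g j t                                     ≡⟨ coeffOf-coordinate r t ⟩
    inv2^ r ℚ.* (halfSum t ℚ.+ ℚ.- sgn j ℚ.* halfSum t)   ≡⟨ cong (λ s → inv2^ r ℚ.* (halfSum t ℚ.+ ℚ.- s ℚ.* halfSum t)) (sgn-cong {j} {0} (mod2 j-even)) ⟩
    inv2^ r ℚ.* (halfSum t ℚ.+ ℚ.- 1ℚ ℚ.* halfSum t)      ≡⟨ cong (inv2^ r ℚ.*_) (x-x≡0 (halfSum t)) ⟩
    inv2^ r ℚ.* 0ℚ                                        ≡⟨ ℚ.*-zeroʳ (inv2^ r) ⟩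
    0ℚ                                                    ∎
    where
    open ≡-Reasoning
    x-x≡0 : ∀ x → x ℚ.+ ℚ.- 1ℚ ℚ.* x ≡ 0ℚ
    x-x≡0 = solve-∀ ℚ-ring

  halfSum-constant : (∀ {i o} → 0 < i → i < N → o % 2 ≡ 1 → ¬ N ∣ i * o) → j % 2 ≡ 1 →
                     halfSum fzero ≡ sgn (g 0)
  halfSum-constant N∤odd j-odd = begin
    sgn (g 0) ℚ.* 1ℚ ℚ.+ sumℚ n (λ i → term (suc i) fzero) ≡⟨ cong₂ ℚ._+_ (ℚ.*-identityʳ (sgn (g 0))) (sumℚ-zero n _ vanishes) ⟩
    sgn (g 0) ℚ.+ 0ℚ                                       ≡⟨ ℚ.+-identityʳ (sgn (g 0)) ⟩
    sgn (g 0)                                              ∎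
    where
    open ≡-Reasoning
    vanishes : ∀ i → i < n → term (suc i) fzero ≡ 0ℚ
    vanishes i i<n = trans (cong (sgn (g (suc i)) ℚ.*_) (ωpow-constant-coordinate _ N∤e)) (ℚ.*-zeroʳ (sgn (g (suc i))))
      where
      N∤e : ¬ N ∣ (suc i * j) * M
      N∤e = N∤odd (s≤s z≤n) (s≤s i<n) (trans (mod2-≡ j*M≡₂j) j-odd) ∘ subst (N ∣_) (ℕ.*-assoc (suc i) j M)

  coeffOf-odd : (∀ {i o} → 0 < i → i < N → o % 2 ≡ 1 → ¬ N ∣ i * o) → j % 2 ≡ 1 →
                ∀ r → ¬ IsZeroC (coeffOf N r g j)
  coeffOf-odd N∤odd j-odd r c≡0 = sgn+sgn≢0 (g 0) (begin
    sgn (g 0) ℚ.+ 1ℚ ℚ.* sgn (g 0)                 ≡⟨ cong₂ (λ x s → x ℚ.+ s ℚ.* x) halfSum≡sgn -sgn[j]≡1 ⟨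
    halfSum fzero ℚ.+ ℚ.- sgn j ℚ.* halfSum fzero  ≡⟨ inv2^*x≡0⇒x≡0 r (trans (sym (coeffOf-coordinate r fzero)) (c≡0 fzero)) ⟩
    0ℚ                                             ∎)
    where
    open ≡-Reasoning
    halfSum≡sgn : halfSum fzero ≡ sgn (g 0)
    halfSum≡sgn = halfSum-constant N∤odd j-odd
    -sgn[j]≡1 : ℚ.- sgn j ≡ 1ℚ
    -sgn[j]≡1 = cong ℚ.-_ (sgn-cong {j} {1} (mod2 j-odd))

coeffOf-parity : ∀ {N n} → N ≡ suc n → ∀ g → (∀ i → g (N + i) ≡₂ suc (g i)) →
                 (∀ {i o} → 0 < i → i < N → o % 2 ≡ 1 → ¬ N ∣ i * o) → ∀ r j →
                 (j % 2 ≡ 0 → IsZeroC (coeffOf N r g j)) × (j % 2 ≡ 1 → ¬ IsZeroC (coeffOf N r g j))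
coeffOf-parity refl g g-antiperiodic N∤odd r j =
  coeffOf-even g g-antiperiodic j r , λ j-odd → coeffOf-odd g g-antiperiodic j N∤odd j-odd r

mainTheorem8 : (m : ℕ) (ks : List ℕ)
    → All (1 ≤_) ks → Linked _<_ ks → last ks ≡ just (2 ^ m)
    → ((j : ℕ) → j < 2 ^ suc m → ((¬ IsZeroC (coeff m ks j)) ⇔ (j % 2 ≡ 1)))
      × IsZeroC (coeff m ks 0)
mainTheorem8 m ks _ ks-sorted last≡2^m =
  (λ j _ → mk⇔ (nonzero⇒odd j) (proj₂ (parity j))) , proj₁ (parity 0) refl
  where
  antiperiodic : ∀ i → binomSum ks (2 ^ m + i) ≡₂ suc (binomSum ks i)
  antiperiodic i = subst (λ k → binomSum ks k ≡₂ suc (binomSum ks i)) (+-comm i (2 ^ m))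
    (binomSum-shift (shiftsBinomials-2^ m) ks-sorted last≡2^m i)

  parity : ∀ j → (j % 2 ≡ 0 → IsZeroC (coeff m ks j)) × (j % 2 ≡ 1 → ¬ IsZeroC (coeff m ks j))
  parity = coeffOf-parity (sym (ℕ.suc-pred (2 ^ m) {{ℕ.m^n≢0 2 m}})) (binomSum ks) antiperiodic
    (2^m∤i*odd m) (suc m)

  nonzero⇒odd : ∀ j → ¬ IsZeroC (coeff m ks j) → j % 2 ≡ 1
  nonzero⇒odd j c≢0 = [ (λ j-even → contradiction (proj₁ (parity j) j-even) c≢0) , id ]′ (%2≡0⊎%2≡1 j)
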